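{- Let $(\mathbf{M},\mathbf{N})$ be an $\mathrm{IMLU}$-category, let $n,k\in\mathbb{N}$, and let $m_R:R\rightarrowtail A_1\times\dots\times A_n$ be a morphism of $\mathbf{N}$ which is monic in $\mathbf{M}$. Then $$\mathbf{M}\models\forall x_1:A_1\dots\forall x_n:A_n.\big(m_R(x_1,\dots,x_n)\leftrightarrow(\hat{\mathbf{T}}^k m_R)(\iota^k x_1,\dots,\iota^k x_n)\big).$$
   Context: Heyting category: finite limits, images, covers stable under pullback, each subobject poset a join-semilattice, each pullback map $f^*$ preserving finite joins with adjoints $\exists_f\dashv f^*\dashv\forall_f$. An $\mathrm{IMLU}$-category is a pair $(\mathbf{M},\mathbf{N})$ of Heyting categories with $\mathbf{N}$ a conservative (isomorphism-reflecting) Heyting subcategory of $\mathbf{M}$, together with: an object $U$ of $\mathbf{N}$ such that every object of $\mathbf{N}$ has a mono in $\mathbf{N}$ into $U$; an endofunctor $\mathbf{T}$ of $\mathbf{M}$ restricting to an endofunctor of $\mathbf{N}$ and a natural isomorphism $\iota:\mathrm{id}_\mathbf{M}\to\mathbf{T}$; an endofunctor $\mathbf{P}$ of $\mathbf{N}$ such that for each object $A$ of $\mathbf{N}$ there is $m_{\subseteq^\mathbf{T}_A}:\subseteq^\mathbf{T}_A\to\mathbf{T}A\times\mathbf{P}A$ in $\mathbf{N}$, monic in $\mathbf{M}$, such that for each $r:R\to\mathbf{T}A\times B$ in $\mathbf{N}$ monic in $\mathbf{M}$ there is $\chi:B\to\mathbf{P}A$ in $\mathbf{N}$ which is the unique morphism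 of $\mathbf{M}$ for which $r$ is a pullback in $\mathbf{M}$ of $m_{\subseteq^\mathbf{T}_A}$ along $\mathrm{id}\times\chi$; and a natural isomorphism $\mu:\mathbf{P}\mathbf{T}\to\mathbf{T}\mathbf{P}$ on $\mathbf{N}$. Fixed products in $\mathbf{M}$ restrict to products in $\mathbf{N}$. Construction of $\hat{\mathbf{T}}$: for $m_R:R\rightarrowtail A_1\times\dots\times A_n$ in $\mathbf{N}$ monic in $\mathbf{M}$, the isomorphism $\theta=\iota_{A_1\times\dots\times A_n}\circ(\iota_{A_1}\times\dots\times\iota_{A_n})^{ -1}:\mathbf{T}A_1\times\dots\times\mathbf{T}A_n\to\mathbf{T}(A_1\times\dots\times A_n)$ is a morphism of $\mathbf{N}$, and $\hat{\mathbf{T}}m_R:\hat{\mathbf{T}}R\rightarrowtail\mathbf{T}A_1\times\dots\times\mathbf{T}A_n$ is defined as the pullback in $\mathbf{N}$ of $\mathbf{T}m_R$ along $\theta$ (this depends on the chosen factorization $A_1\times\dots\times A_n$ of the codomain). $\hat{\mathbf{T}}^0m_R=m_R$ and $\hat{\mathbf{T}}^{j+1}m_R=\hat{\mathbf{T}}(\hat{\mathbf{T}}^jm_R)$ with codomain factorized as $\mathbf{T}^{j+1}A_1\times\dots\times\mathbf{T}^{j+1}A_n$. Iterated $\iota$: $\iota^0_A=\mathrm{id}_A$, $\iota^{j+1}_A=\iota_{\mathbf{T}^jA}\circ\iota^j_A:A\to\mathbf{T}^{j+1}A$. $\mathbf{M}\models\phi$ means validity in the natural structure in $\mathbf{M}$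 (objects as sorts, morphisms as function symbols, monos as relation symbols interpreted by the subobjects they determine) under the standard categorical semantics of Heyting categories. -}

module Defs where

open import Level using (Level; _⊔_) renaming (suc to lsuc)
open import Data.Nat using (ℕ; zero; suc)
open import Data.Fin using (Fin; zero; suc)
open import Data.Product using (Σ; Σ-syntax; _×_; _,_; proj₁; proj₂)
open import Function.Bundles using (_⇔_)
open import Relation.Binary.Structures using (IsEquivalence)

record Category (o ℓ e : Level) : Set (lsuc (o ⊔ ℓ ⊔ e)) where
  infixr 9 _∘_
  infix 4 _≈_
  field
    Obj : Set o
    _⇒_ : Obj → Obj → Set ℓ
    _≈_ : ∀ {A B} → A ⇒ B → A ⇒ B → Set e
    id : ∀ {A} → A ⇒ A
    _∘_ : ∀ {A B Z} → B ⇒ Z → A ⇒ B → A ⇒ Z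
    equiv : ∀ {A B} → IsEquivalence (_≈_ {A} {B})
    ∘-resp-≈ : ∀ {A B Z} {f f' : B ⇒ Z} {g g' : A ⇒ B} → f ≈ f' → g ≈ g' → f ∘ g ≈ f' ∘ g'
    identityˡ : ∀ {A B} {f : A ⇒ B} → id ∘ f ≈ f
    identityʳ : ∀ {A B} {f : A ⇒ B} → f ∘ id ≈ f
    assoc : ∀ {A B Z D} {f : A ⇒ B} {g : B ⇒ Z} {h : Z ⇒ D} → (h ∘ g) ∘ f ≈ h ∘ (g ∘ f)

module Notions {o ℓ e} (C : Category o ℓ e) where
  open Category C

  Mono : ∀ {A B} → A ⇒ B → Set (o ⊔ ℓ ⊔ e)
  Mono {A} f = ∀ {X} (g h : X ⇒ A) → f ∘ g ≈ f ∘ h → g ≈ h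

  IsIso : ∀ {A B} → A ⇒ B → Set (ℓ ⊔ e)
  IsIso {A} {B} f = Σ[ g ∈ B ⇒ A ] ((g ∘ f ≈ id) × (f ∘ g ≈ id))

  -- f factors through g   (as subobjects: f ≤ g)
  Factors : ∀ {X Y A} → X ⇒ A → Y ⇒ A → Set (ℓ ⊔ e)
  Factors {X} {Y} f g = Σ[ h ∈ X ⇒ Y ] (g ∘ h ≈ f)

  record Subobj (A : Obj) : Set (o ⊔ ℓ ⊔ e) where
    field
      dom : Obj
      arr : dom ⇒ A
      mono : Mono arr
  open Subobj public

  -- the square  f ∘ p₁ ≈ g ∘ p₂  is a pullback (p₁ is the pullback of g along f)
  IsPullback : ∀ {A B Z P} (f : A ⇒ Z) (g : B ⇒ Z) (p₁ : P ⇒ A) (p₂ : P ⇒ B) → Set (o ⊔ ℓ ⊔ e)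
  IsPullback {A} {B} {Z} {P} f g p₁ p₂ =
    (f ∘ p₁ ≈ g ∘ p₂) ×
    (∀ {X} (h : X ⇒ A) (k : X ⇒ B) → f ∘ h ≈ g ∘ k →
       Σ[ u ∈ X ⇒ P ] (((p₁ ∘ u ≈ h) × (p₂ ∘ u ≈ k)) ×
                       (∀ (v : X ⇒ P) → p₁ ∘ v ≈ h → p₂ ∘ v ≈ k → v ≈ u)))

  record Pullback {A B Z} (f : A ⇒ Z) (g : B ⇒ Z) : Set (o ⊔ ℓ ⊔ e) where
    field
      P : Obj
      p₁ : P ⇒ A
      p₂ : P ⇒ B
      isPullback : IsPullback f g p₁ p₂

  IsProduct : ∀ {n} (A : Fin n → Obj) (P : Obj) (π : (i : Fin n) → P ⇒ A i) → Set (o ⊔ ℓ ⊔ e)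
  IsProduct {n} A P π =
    ∀ {X} (f : (i : Fin n) → X ⇒ A i) →
      Σ[ u ∈ X ⇒ P ] ((∀ i → π i ∘ u ≈ f i) × (∀ (v : X ⇒ P) → (∀ i → π i ∘ v ≈ f i) → v ≈ u))

  record FinProducts : Set (o ⊔ ℓ ⊔ e) where
    field
      prod : ∀ {n} → (Fin n → Obj) → Obj
      π : ∀ {n} (A : Fin n → Obj) (i : Fin n) → prod A ⇒ A i
      isProduct : ∀ {n} (A : Fin n → Obj) → IsProduct A (prod A) (π A)

    tuple : ∀ {n} {A : Fin n → Obj} {X} → ((i : Fin n) → X ⇒ A i) → X ⇒ prod A
    tuple {A = A} f = proj₁ (isProduct A f)

  pair : Obj → Obj → Fin 2 → Obj
  pair X Y zero = X
  pair X Y (suc _) = Y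

  IsCover : ∀ {A B} → A ⇒ B → Set (o ⊔ ℓ ⊔ e)
  IsCover {A} {B} f = ∀ (S : Subobj B) → Factors f (arr S) → IsIso (arr S)

  IsImage : ∀ {A B Y} → A ⇒ B → Y ⇒ B → Set (o ⊔ ℓ ⊔ e)
  IsImage {A} {B} f m = Factors f m × (∀ (S : Subobj B) → Factors f (arr S) → Factors m (arr S))

  IsBottom : ∀ {X A} → X ⇒ A → Set (o ⊔ ℓ ⊔ e)
  IsBottom {X} {A} b = ∀ (S : Subobj A) → Factors b (arr S)

  IsJoin : ∀ {X Y J A} → X ⇒ A → Y ⇒ A → J ⇒ A → Set (o ⊔ ℓ ⊔ e)
  IsJoin {A = A} s t j =
    Factors s j × Factors t j ×
    (∀ (S : Subobj A) → Factors s (arr S) → Factors t (arr S) → Factors j (arr S))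

  private
    module E {A B} = IsEquivalence (equiv {A} {B})

  pullback-mono : ∀ {A B Z P} {f : A ⇒ Z} {g : B ⇒ Z} {p₁ : P ⇒ A} {p₂ : P ⇒ B} →
                  IsPullback f g p₁ p₂ → Mono g → Mono p₁
  pullback-mono {f = f} {g} {p₁} {p₂} (comm , univ) gm x y eq = E.trans xu (E.sym yu)
    where
      e2 : p₂ ∘ x ≈ p₂ ∘ y
      e2 = gm (p₂ ∘ x) (p₂ ∘ y)
             (E.trans (E.sym assoc)
             (E.trans (∘-resp-≈ (E.sym comm) E.refl)
             (E.trans assoc
             (E.trans (∘-resp-≈ E.refl eq)
             (E.trans (E.sym assoc)
             (E.trans (∘-resp-≈ comm E.refl) assoc))))))
      sq : f ∘ (p₁ ∘ y) ≈ g ∘ (p₂ ∘ y)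
      sq = E.trans (E.sym assoc) (E.trans (∘-resp-≈ comm E.refl) assoc)
      U = univ (p₁ ∘ y) (p₂ ∘ y) sq
      xu = proj₂ (proj₂ U) x eq e2
      yu = proj₂ (proj₂ U) y E.refl E.refl

  module WithPullbacks (pb : ∀ {A B Z} (f : A ⇒ Z) (g : B ⇒ Z) → Pullback f g) where

    pullSub : ∀ {A B} (f : A ⇒ B) → Subobj B → Subobj A
    pullSub f S = record
      { dom = Pullback.P (pb f (arr S))
      ; arr = Pullback.p₁ (pb f (arr S))
      ; mono = pullback-mono (Pullback.isPullback (pb f (arr S))) (mono S) }

    IsExists : ∀ {A B X Y} (f : A ⇒ B) → X ⇒ A → Y ⇒ B → Set (o ⊔ ℓ ⊔ e)
    IsExists {B = B} f s ex = ∀ (T : Subobj B) → Factors ex (arr T) ⇔ Factors s (arr (pullSub f T))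

    IsForall : ∀ {A B X Y} (f : A ⇒ B) → X ⇒ A → Y ⇒ B → Set (o ⊔ ℓ ⊔ e)
    IsForall {B = B} f s a = ∀ (T : Subobj B) → Factors (arr T) a ⇔ Factors (arr (pullSub f T)) s

record IsHeyting {o ℓ e} (C : Category o ℓ e) : Set (o ⊔ ℓ ⊔ e) where
  open Category C
  open Notions C
  field
    -- finite limits (terminal object = empty product)
    products : FinProducts
    pullback : ∀ {A B Z} (f : A ⇒ Z) (g : B ⇒ Z) → Pullback f g
    image : ∀ {A B} (f : A ⇒ B) → Subobj B
    isImage : ∀ {A B} (f : A ⇒ B) → IsImage f (arr (image f))
    cover-stable : ∀ {A B Z P} {f : A ⇒ Z} {g : B ⇒ Z} {p₁ : P ⇒ A} {p₂ : P ⇒ B} →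
                   IsPullback f g p₁ p₂ → IsCover g → IsCover p₁
    bottom : ∀ A → Subobj A
    isBottom : ∀ A → IsBottom (arr (bottom A))
    join : ∀ {A} → Subobj A → Subobj A → Subobj A
    isJoin : ∀ {A} (S T : Subobj A) → IsJoin (arr S) (arr T) (arr (join S T))
    pull-bottom : ∀ {A B} (f : A ⇒ B) → IsBottom (arr (WithPullbacks.pullSub pullback f (bottom B)))
    pull-join : ∀ {A B} (f : A ⇒ B) (S T : Subobj B) →
                IsJoin (arr (WithPullbacks.pullSub pullback f S))
                       (arr (WithPullbacks.pullSub pullback f T))
                       (arr (WithPullbacks.pullSub pullback f (join S T)))
    exists : ∀ {A B} (f : A ⇒ B) → Subobj A → Subobj B
    isExists : ∀ {A B} (f : A ⇒ B) (S : Subobj A) →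
               WithPullbacks.IsExists pullback f (arr S) (arr (exists f S))
    forallS : ∀ {A B} (f : A ⇒ B) → Subobj A → Subobj B
    isForallS : ∀ {A B} (f : A ⇒ B) (S : Subobj A) →
               WithPullbacks.IsForall pullback f (arr S) (arr (forallS f S))

record Functor {o ℓ e o' ℓ' e'} (C : Category o ℓ e) (D : Category o' ℓ' e')
       : Set (o ⊔ ℓ ⊔ e ⊔ o' ⊔ ℓ' ⊔ e') where
  private
    module C = Category C
    module D = Category D
  field
    F₀ : C.Obj → D.Obj
    F₁ : ∀ {A B} → A C.⇒ B → F₀ A D.⇒ F₀ B
    F-resp-≈ : ∀ {A B} {f g : A C.⇒ B} → f C.≈ g → F₁ f D.≈ F₁ g
    F-id : ∀ {A} → F₁ (C.id {A}) D.≈ D.id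
    F-∘ : ∀ {A B Z} {f : A C.⇒ B} {g : B C.⇒ Z} → F₁ (g C.∘ f) D.≈ F₁ g D.∘ F₁ f

idF : ∀ {o ℓ e} (C : Category o ℓ e) → Functor C C
idF C = record
  { F₀ = λ A → A ; F₁ = λ f → f ; F-resp-≈ = λ p → p
  ; F-id = IsEquivalence.refl (Category.equiv C)
  ; F-∘ = IsEquivalence.refl (Category.equiv C) }

_∘F_ : ∀ {o ℓ e} {C D E : Category o ℓ e} → Functor D E → Functor C D → Functor C E
_∘F_ {E = E} G F = record
  { F₀ = λ A → G.F₀ (F.F₀ A)
  ; F₁ = λ f → G.F₁ (F.F₁ f)
  ; F-resp-≈ = λ p → G.F-resp-≈ (F.F-resp-≈ p)
  ; F-id = IsEquivalence.trans (Category.equiv E) (G.F-resp-≈ F.F-id) G.F-id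
  ; F-∘ = IsEquivalence.trans (Category.equiv E) (G.F-resp-≈ F.F-∘) G.F-∘ }
  where
    module F = Functor F
    module G = Functor G

record NatIso {o ℓ e o' ℓ' e'} {C : Category o ℓ e} {D : Category o' ℓ' e'}
       (F G : Functor C D) : Set (o ⊔ ℓ ⊔ e ⊔ o' ⊔ ℓ' ⊔ e') where
  private
    module C = Category C
    module D = Category D
    module F = Functor F
    module G = Functor G
  field
    η : ∀ A → F.F₀ A D.⇒ G.F₀ A
    natural : ∀ {A B} (f : A C.⇒ B) → G.F₁ f D.∘ η A D.≈ η B D.∘ F.F₁ f
    iso : ∀ A → Notions.IsIso D (η A)

  inv : ∀ A → G.F₀ A D.⇒ F.F₀ A
  inv A = proj₁ (iso A)

record Subcategory {o ℓ e} (C : Category o ℓ e) : Set (lsuc (o ⊔ ℓ) ⊔ e) where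
  open Category C
  field
    ObjP : Obj → Set o
    HomP : ∀ {A B} → A ⇒ B → Set ℓ
    id-closed : ∀ {A} → ObjP A → HomP (id {A})
    ∘-closed : ∀ {A B Z} {f : B ⇒ Z} {g : A ⇒ B} → HomP f → HomP g → HomP (f ∘ g)

SubCat : ∀ {o ℓ e} {C : Category o ℓ e} → Subcategory C → Category o ℓ e
SubCat {C = C} S = record
  { Obj = Σ Obj ObjP
  ; _⇒_ = λ A B → Σ (proj₁ A ⇒ proj₁ B) HomP
  ; _≈_ = λ f g → proj₁ f ≈ proj₁ g
  ; id = λ {A} → id , id-closed (proj₂ A)
  ; _∘_ = λ f g → (proj₁ f ∘ proj₁ g) , ∘-closed (proj₂ f) (proj₂ g)
  ; equiv = record { refl = E.refl ; sym = E.sym ; trans = E.trans }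
  ; ∘-resp-≈ = ∘-resp-≈
  ; identityˡ = identityˡ
  ; identityʳ = identityʳ
  ; assoc = assoc }
  where
    open Category C
    open Subcategory S
    module E {A B} = IsEquivalence (equiv {A} {B})

restrictF : ∀ {o ℓ e} {C : Category o ℓ e} (S : Subcategory C) (T : Functor C C) →
            (∀ {A} → Subcategory.ObjP S A → Subcategory.ObjP S (Functor.F₀ T A)) →
            (∀ {A B} {f : Category._⇒_ C A B} → Subcategory.HomP S f →
               Subcategory.HomP S (Functor.F₁ T f)) →
            Functor (SubCat S) (SubCat S)
restrictF S T ro rh = record
  { F₀ = λ A → F₀ (proj₁ A) , ro (proj₂ A)
  ; F₁ = λ f → F₁ (proj₁ f) , rh (proj₂ f)
  ; F-resp-≈ = F-resp-≈
  ; F-id = F-id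
  ; F-∘ = F-∘ }
  where open Functor T

-- Heyting subcategories: the inclusion is a conservative Heyting functor,
-- and the fixed products of M restrict to products of N.

record IsConservativeHeytingSubcategory {o ℓ e} (M : Category o ℓ e) (HM : IsHeyting M)
       (N : Subcategory M) (HN : IsHeyting (SubCat N)) : Set (lsuc (o ⊔ ℓ) ⊔ e) where
  private
    module M = Category M
    module N = Category (SubCat N)
    module MN = Notions M
    module NN = Notions (SubCat N)
    module HM = IsHeyting HM
    module HN = IsHeyting HN
    module S = Subcategory N
    open MN.FinProducts HM.products
  field
    prod-obj : ∀ {n} (A : Fin n → M.Obj) → (∀ i → S.ObjP (A i)) → S.ObjP (prod A)
    prod-proj : ∀ {n} (A : Fin n → M.Obj) → (∀ i → S.ObjP (A i)) → ∀ i → S.HomP (π A i)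
    prod-tuple : ∀ {n} (A : Fin n → M.Obj) → (∀ i → S.ObjP (A i)) →
                 ∀ {X} → S.ObjP X → (f : (i : Fin n) → X M.⇒ A i) → (∀ i → S.HomP (f i)) →
                 S.HomP (tuple f)
    -- the inclusion preserves pullbacks (hence, with the above, finite limits)
    pres-pullback : ∀ {A B Z P : N.Obj} {f : A N.⇒ Z} {g : B N.⇒ Z} {p₁ : P N.⇒ A} {p₂ : P N.⇒ B} →
                    NN.IsPullback {A} {B} {Z} {P} f g p₁ p₂ → MN.IsPullback (proj₁ f) (proj₁ g) (proj₁ p₁) (proj₁ p₂)
    -- ... covers (hence images)
    pres-cover : ∀ {A B : N.Obj} {f : A N.⇒ B} → NN.IsCover {A} {B} f → MN.IsCover (proj₁ f)
    pres-bottom : ∀ (A : N.Obj) → MN.IsBottom (proj₁ (NN.arr (HN.bottom A)))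
    pres-join : ∀ {A : N.Obj} (U V : NN.Subobj A) →
                MN.IsJoin (proj₁ (NN.arr U)) (proj₁ (NN.arr V)) (proj₁ (NN.arr (HN.join U V)))
    pres-forallS : ∀ {A B : N.Obj} (f : A N.⇒ B) (U : NN.Subobj A) →
                  MN.WithPullbacks.IsForall HM.pullback (proj₁ f) (proj₁ (NN.arr U))
                    (proj₁ (NN.arr (HN.forallS {A} {B} f U)))
    conservative : ∀ {A B : N.Obj} (f : A N.⇒ B) → MN.IsIso (proj₁ f) → NN.IsIso {A} {B} f

record IMLU {o ℓ e} (M : Category o ℓ e) (HM : IsHeyting M)
       (N : Subcategory M) (HN : IsHeyting (SubCat N)) : Set (lsuc (o ⊔ ℓ) ⊔ e) where
  private
    module M = Category M
    module N = Category (SubCat N)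
    module MN = Notions M
    module NN = Notions (SubCat N)
    module HM = IsHeyting HM
    module S = Subcategory N
    open MN.FinProducts HM.products
  field
    heytingSub : IsConservativeHeytingSubcategory M HM N HN
    U : N.Obj
    embed : ∀ (A : N.Obj) → Σ[ m ∈ A N.⇒ U ] NN.Mono {A} {U} m
    T : Functor M M
    T-obj : ∀ {A} → S.ObjP A → S.ObjP (Functor.F₀ T A)
    T-hom : ∀ {A B} {f : A M.⇒ B} → S.HomP f → S.HomP (Functor.F₁ T f)
    ι : NatIso (idF M) T
    P : Functor (SubCat N) (SubCat N)
    memDom : N.Obj → M.Obj
    memDomN : ∀ A → S.ObjP (memDom A)
    memArr : ∀ (A : N.Obj) →
             memDom A M.⇒ prod (MN.pair (Functor.F₀ T (proj₁ A)) (proj₁ (Functor.F₀ P A)))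
    memHom : ∀ A → S.HomP (memArr A)
    memMono : ∀ A → MN.Mono (memArr A)
    classify : ∀ (A : N.Obj) {B R : M.Obj} → S.ObjP B → S.ObjP R →
               (r : R M.⇒ prod (MN.pair (Functor.F₀ T (proj₁ A)) B)) → S.HomP r → MN.Mono r →
               let IsClassifier : (B M.⇒ proj₁ (Functor.F₀ P A)) → Set (o ⊔ ℓ ⊔ e)
                   IsClassifier χ =
                     Σ[ q ∈ R M.⇒ memDom A ]
                       MN.IsPullback
                         (tuple (λ { zero → π _ zero ; (suc zero) → χ M.∘ π _ (suc zero) }))
                         (memArr A) r q
               in Σ[ χ ∈ B M.⇒ proj₁ (Functor.F₀ P A) ]
                    (S.HomP χ × IsClassifier χ ×
                     (∀ (χ' : B M.⇒ proj₁ (Functor.F₀ P A)) → IsClassifier χ' → χ' M.≈ χ))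
    μ : NatIso (P ∘F restrictF N T T-obj T-hom) (restrictF N T T-obj T-hom ∘F P)

module Hat {o ℓ e} {M : Category o ℓ e} {HM : IsHeyting M}
           {N : Subcategory M} {HN : IsHeyting (SubCat N)} (I : IMLU M HM N HN) where
  open Category M
  open Notions M
  open IsHeyting HM
  open FinProducts products
  open IMLU I using (T; ι)
  open Functor T
  module ι = NatIso ι

  iterT : ℕ → Obj → Obj
  iterT zero A = A
  iterT (suc j) A = F₀ (iterT j A)

  iotaIter : (j : ℕ) (A : Obj) → A ⇒ iterT j A
  iotaIter zero A = id
  iotaIter (suc j) A = ι.η (iterT j A) ∘ iotaIter j A

  θ : ∀ {n} (A : Fin n → Obj) → prod (λ i → F₀ (A i)) ⇒ F₀ (prod A)
  θ A = ι.η (prod A) ∘ tuple (λ i → ι.inv (A i) ∘ π (λ i → F₀ (A i)) i)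

  hat : ∀ {n} (A : Fin n → Obj) {R} (m : R ⇒ prod A) → Σ[ X ∈ Obj ] (X ⇒ prod (λ i → F₀ (A i)))
  hat A m = Pullback.P (pullback (θ A) (F₁ m)) , Pullback.p₁ (pullback (θ A) (F₁ m))

  hatIter : (j : ℕ) → ∀ {n} (A : Fin n → Obj) {R} (m : R ⇒ prod A) →
            Σ[ X ∈ Obj ] (X ⇒ prod (λ i → iterT j (A i)))
  hatIter zero A {R} m = R , m
  hatIter (suc j) A m = hat (λ i → iterT j (A i)) (proj₂ (hatIter j A m))

  -- interpretation of the atomic formula  r(t₁,…,tₙ)  in context  A₁×…×Aₙ
  atom : ∀ {n} (A : Fin n → Obj) {m} (B : Fin m → Obj) {R} (r : R ⇒ prod B) →
         ((i : Fin m) → prod A ⇒ B i) → Σ[ X ∈ Obj ] (X ⇒ prod A)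
  atom A B r ts = Pullback.P (pullback (tuple ts) r) , Pullback.p₁ (pullback (tuple ts) r)

  -- M ⊨ ∀x₁:A₁…∀xₙ:Aₙ. ( m_R(x₁,…,xₙ) ↔ (T̂^k m_R)(ι^k x₁,…,ι^k xₙ) ),
  -- i.e. the two interpreted subobjects of A₁×…×Aₙ coincide.
  Theorem18Concl : ∀ {n} (k : ℕ) (A : Fin n → Obj) {R} (m : R ⇒ prod A) → Set (ℓ ⊔ e)
  Theorem18Concl k A m =
    Factors (proj₂ lhs) (proj₂ rhs) × Factors (proj₂ rhs) (proj₂ lhs)
    where
      lhs = atom A A m (λ i → π A i)
      rhs = atom A (λ i → iterT k (A i)) (proj₂ (hatIter k A m))
                 (λ i → iotaIter k (A i) ∘ π A i)

{-# OPTIONS --safe #-}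
-- Subobjects are compared through their generalized elements: h lies in the
-- pullback of r along f iff f ∘ h lies in r.  As ι is a natural isomorphism,
-- h lies in m iff ι ∘ h lies in T m, and θ ∘ (ι × … × ι) = ι, so h lies in m iff
-- (ι × … × ι) ∘ h lies in T̂ m.  After k iterations both sides of the
-- biconditional have the same generalized elements, hence are the same subobject.
module Submission where

open import Level using (_⊔_)
open import Defs
open import Data.Nat using (ℕ; zero; suc)
open import Data.Fin using (Fin)
open import Data.Product using (_×_; _,_; proj₁; proj₂)
open import Function.Bundles using (_⇔_; mk⇔; module Equivalence)
open import Function.Properties.Equivalence using (⇔-setoid)
open import Relation.Binary.Bundles using (Setoid)
open import Relation.Binary.Structures using (IsEquivalence)
import Relation.Binary.Reasoning.Setoid as SetoidReasoning

module ⇔-Reasoning {a} = SetoidReasoning (⇔-setoid a)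

module Morphisms {o ℓ e} (C : Category o ℓ e) where
  open Category C

  hom-setoid : Obj → Obj → Setoid ℓ e
  hom-setoid A B = record { Carrier = A ⇒ B ; _≈_ = _≈_ ; isEquivalence = equiv }

  module ≈ {A B} = IsEquivalence (equiv {A} {B})
  module HomReasoning {A B} = SetoidReasoning (hom-setoid A B)

  infixr 4 refl⟩∘⟨_
  infixl 5 _⟩∘⟨refl

  refl⟩∘⟨_ : ∀ {A B Z} {f : B ⇒ Z} {g g' : A ⇒ B} → g ≈ g' → f ∘ g ≈ f ∘ g'
  refl⟩∘⟨ p = ∘-resp-≈ ≈.refl p

  _⟩∘⟨refl : ∀ {A B Z} {f f' : B ⇒ Z} {g : A ⇒ B} → f ≈ f' → f ∘ g ≈ f' ∘ g
  p ⟩∘⟨refl = ∘-resp-≈ p ≈.refl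

  pullˡ : ∀ {A B Z D} {f : Z ⇒ D} {g : B ⇒ Z} {h : B ⇒ D} {k : A ⇒ B} →
          f ∘ g ≈ h → f ∘ (g ∘ k) ≈ h ∘ k
  pullˡ p = ≈.trans (≈.sym assoc) (p ⟩∘⟨refl)

  cancelˡ : ∀ {A B Z} {f : B ⇒ Z} {g : Z ⇒ B} {h : A ⇒ B} → g ∘ f ≈ id → g ∘ (f ∘ h) ≈ h
  cancelˡ p = ≈.trans (pullˡ p) identityˡ

module Factorisation {o ℓ e} (C : Category o ℓ e) where
  open Category C
  open Notions C
  open Morphisms C

  SameSubobject : ∀ {X Y A} → X ⇒ A → Y ⇒ A → Set (ℓ ⊔ e)
  SameSubobject s t = Factors s t × Factors t s

  Factors-cong : ∀ {X Y A} {f f' : X ⇒ A} {g : Y ⇒ A} → f ≈ f' → Factors f g ⇔ Factors f' g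
  Factors-cong p = mk⇔ (λ (u , gu) → u , ≈.trans gu p) (λ (u , gu) → u , ≈.trans gu (≈.sym p))

  SameSubobject-fromElements : ∀ {S T A} {s : S ⇒ A} {t : T ⇒ A} →
    (∀ {X} (h : X ⇒ A) → Factors h s ⇔ Factors h t) → SameSubobject s t
  SameSubobject-fromElements {s = s} {t} same =
    Equivalence.to (same s) (id , identityʳ) , Equivalence.from (same t) (id , identityʳ)

  Factors-pullback : ∀ {A B Z P X} {f : A ⇒ Z} {g : B ⇒ Z} {p₁ : P ⇒ A} {p₂ : P ⇒ B} →
    IsPullback f g p₁ p₂ → (h : X ⇒ A) → Factors h p₁ ⇔ Factors (f ∘ h) g
  Factors-pullback {f = f} {g} {p₁} {p₂} (commutes , universal) h = mk⇔ to from
    where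
      to : Factors h p₁ → Factors (f ∘ h) g
      to (u , p₁u) = p₂ ∘ u , (begin
        g ∘ (p₂ ∘ u)   ≈⟨ pullˡ (≈.sym commutes) ⟩
        (f ∘ p₁) ∘ u   ≈⟨ assoc ⟩
        f ∘ (p₁ ∘ u)   ≈⟨ refl⟩∘⟨ p₁u ⟩
        f ∘ h          ∎)
        where open HomReasoning
      from : Factors (f ∘ h) g → Factors h p₁
      from (w , gw) = let (u , (p₁u , _) , _) = universal h w (≈.sym gw) in u , p₁u

  Factors-iso : ∀ {R R' P P' X} {m : R ⇒ P} {m' : R' ⇒ P'} {u : P ⇒ P'} {v : R ⇒ R'} →
    IsIso u → IsIso v → u ∘ m ≈ m' ∘ v → (g : X ⇒ P) → Factors g m ⇔ Factors (u ∘ g) m'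
  Factors-iso {m = m} {m'} {u} {v} (u⁻¹ , u⁻¹u , _) (v⁻¹ , _ , vv⁻¹) square g = mk⇔ to from
    where
      open HomReasoning
      to : Factors g m → Factors (u ∘ g) m'
      to (w , mw) = v ∘ w , (begin
        m' ∘ (v ∘ w)   ≈⟨ pullˡ (≈.sym square) ⟩
        (u ∘ m) ∘ w    ≈⟨ assoc ⟩
        u ∘ (m ∘ w)    ≈⟨ refl⟩∘⟨ mw ⟩
        u ∘ g          ∎)
      from : Factors (u ∘ g) m' → Factors g m
      from (w , m'w) = v⁻¹ ∘ w , (begin
        m ∘ (v⁻¹ ∘ w)               ≈˘⟨ cancelˡ u⁻¹u ⟩
        u⁻¹ ∘ (u ∘ (m ∘ (v⁻¹ ∘ w))) ≈⟨ refl⟩∘⟨ pullˡ square ⟩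
        u⁻¹ ∘ ((m' ∘ v) ∘ (v⁻¹ ∘ w)) ≈⟨ refl⟩∘⟨ assoc ⟩
        u⁻¹ ∘ (m' ∘ (v ∘ (v⁻¹ ∘ w))) ≈⟨ refl⟩∘⟨ refl⟩∘⟨ cancelˡ vv⁻¹ ⟩
        u⁻¹ ∘ (m' ∘ w)              ≈⟨ refl⟩∘⟨ m'w ⟩
        u⁻¹ ∘ (u ∘ g)               ≈⟨ cancelˡ u⁻¹u ⟩
        g                           ∎)

module ProductMaps {o ℓ e} {C : Category o ℓ e} (products : Notions.FinProducts C) where
  open Category C
  open Notions.FinProducts products
  open Morphisms C

  tuple-π : ∀ {n} {A : Fin n → Obj} {X} (f : (i : Fin n) → X ⇒ A i) i → π A i ∘ tuple f ≈ f i
  tuple-π {A = A} f = proj₁ (proj₂ (isProduct A f))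

  tuple-unique : ∀ {n} {A : Fin n → Obj} {X} {f : (i : Fin n) → X ⇒ A i} (v : X ⇒ prod A) →
                 (∀ i → π A i ∘ v ≈ f i) → v ≈ tuple f
  tuple-unique {A = A} {f = f} = proj₂ (proj₂ (isProduct A f))

  tuple-π-id : ∀ {n} (A : Fin n → Obj) → tuple (π A) ≈ id
  tuple-π-id A = ≈.sym (tuple-unique id (λ i → identityʳ))

  prodMap : ∀ {n} {A B : Fin n → Obj} → (∀ i → A i ⇒ B i) → prod A ⇒ prod B
  prodMap {A = A} f = tuple (λ i → f i ∘ π A i)

  prodMap-id : ∀ {n} {A : Fin n → Obj} {f : ∀ i → A i ⇒ A i} → (∀ i → f i ≈ id) → prodMap f ≈ id
  prodMap-id {A = A} {f} f≈id = ≈.sym (tuple-unique id π-id)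
    where
      open HomReasoning
      π-id : ∀ i → π A i ∘ id ≈ f i ∘ π A i
      π-id i = begin
        π A i ∘ id       ≈⟨ identityʳ ⟩
        π A i            ≈˘⟨ identityˡ ⟩
        id ∘ π A i       ≈˘⟨ f≈id i ⟩∘⟨refl ⟩
        f i ∘ π A i      ∎

  prodMap-∘ : ∀ {n} {A B Z : Fin n → Obj} (f : ∀ i → B i ⇒ Z i) (g : ∀ i → A i ⇒ B i) →
              prodMap f ∘ prodMap g ≈ prodMap (λ i → f i ∘ g i)
  prodMap-∘ {A = A} {B} {Z} f g = tuple-unique (prodMap f ∘ prodMap g) π-∘
    where
      open HomReasoning
      π-∘ : ∀ i → π Z i ∘ (prodMap f ∘ prodMap g) ≈ (f i ∘ g i) ∘ π A i
      π-∘ i = begin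
        π Z i ∘ (prodMap f ∘ prodMap g)  ≈⟨ pullˡ (tuple-π _ i) ⟩
        (f i ∘ π B i) ∘ prodMap g        ≈⟨ assoc ⟩
        f i ∘ (π B i ∘ prodMap g)        ≈⟨ refl⟩∘⟨ tuple-π _ i ⟩
        f i ∘ (g i ∘ π A i)              ≈˘⟨ assoc ⟩
        (f i ∘ g i) ∘ π A i              ∎

module Theorem18 {o ℓ e} {M : Category o ℓ e} {HM : IsHeyting M}
                 {N : Subcategory M} {HN : IsHeyting (SubCat N)} (I : IMLU M HM N HN) where
  open Category M
  open Notions M
  open IsHeyting HM
  open FinProducts products
  open IMLU I using (T; ι)
  open Functor T
  open Hat I using (iterT; iotaIter; θ; hat; hatIter; atom; Theorem18Concl)
  module ι = NatIso ι
  open Morphisms M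
  open Factorisation M
  open ProductMaps products

  ι× : ∀ {n} (B : Fin n → Obj) → prod B ⇒ prod (λ i → F₀ (B i))
  ι× B = prodMap (λ i → ι.η (B i))

  ιᵏ× : ∀ {n} (k : ℕ) (A : Fin n → Obj) → prod A ⇒ prod (λ i → iterT k (A i))
  ιᵏ× k A = prodMap (λ i → iotaIter k (A i))

  θ∘ι× : ∀ {n} (B : Fin n → Obj) → θ B ∘ ι× B ≈ ι.η (prod B)
  θ∘ι× B = begin
    θ B ∘ ι× B                                        ≈⟨ assoc ⟩
    ι.η (prod B) ∘ (prodMap ι⁻¹ ∘ ι× B)               ≈⟨ refl⟩∘⟨ prodMap-∘ ι⁻¹ (λ i → ι.η (B i)) ⟩
    ι.η (prod B) ∘ prodMap (λ i → ι⁻¹ i ∘ ι.η (B i))  ≈⟨ refl⟩∘⟨ prodMap-id ι⁻¹∘ι ⟩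
    ι.η (prod B) ∘ id                                 ≈⟨ identityʳ ⟩
    ι.η (prod B)                                      ∎
    where
      open HomReasoning
      ι⁻¹ : ∀ i → F₀ (B i) ⇒ B i
      ι⁻¹ i = ι.inv (B i)
      ι⁻¹∘ι : ∀ i → ι⁻¹ i ∘ ι.η (B i) ≈ id
      ι⁻¹∘ι i = proj₁ (proj₂ (ι.iso (B i)))

  Factors-T : ∀ {R P X} (m : R ⇒ P) (g : X ⇒ P) → Factors g m ⇔ Factors (ι.η P ∘ g) (F₁ m)
  Factors-T {R} {P} m = Factors-iso (ι.iso P) (ι.iso R) (≈.sym (ι.natural m))

  Factors-hat : ∀ {n} (B : Fin n → Obj) {R X} (m : R ⇒ prod B) (g : X ⇒ prod B) →
                Factors g m ⇔ Factors (ι× B ∘ g) (proj₂ (hat B m))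
  Factors-hat B m g = begin
    Factors g m                           ≈⟨ Factors-T m g ⟩
    Factors (ι.η (prod B) ∘ g) (F₁ m)     ≈˘⟨ Factors-cong (pullˡ (θ∘ι× B)) ⟩
    Factors (θ B ∘ (ι× B ∘ g)) (F₁ m)     ≈˘⟨ Factors-pullback hat-isPullback (ι× B ∘ g) ⟩
    Factors (ι× B ∘ g) (proj₂ (hat B m))  ∎
    where
      open ⇔-Reasoning
      hat-isPullback = Pullback.isPullback (pullback (θ B) (F₁ m))

  Factors-hatIter : ∀ (k : ℕ) {n} (A : Fin n → Obj) {R X} (m : R ⇒ prod A) (g : X ⇒ prod A) →
                    Factors g m ⇔ Factors (ιᵏ× k A ∘ g) (proj₂ (hatIter k A m))
  Factors-hatIter zero A m g =
    Factors-cong (≈.sym (≈.trans (prodMap-id (λ i → ≈.refl) ⟩∘⟨refl) identityˡ))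
  Factors-hatIter (suc k) A m g = begin
    Factors g m                                                ≈⟨ Factors-hatIter k A m g ⟩
    Factors (ιᵏ× k A ∘ g) mᵏ                                   ≈⟨ Factors-hat Aᵏ mᵏ (ιᵏ× k A ∘ g) ⟩
    Factors (ι× Aᵏ ∘ (ιᵏ× k A ∘ g)) (proj₂ (hat Aᵏ mᵏ))        ≈⟨ Factors-cong (pullˡ (prodMap-∘ _ _)) ⟩
    Factors (ιᵏ× (suc k) A ∘ g) (proj₂ (hatIter (suc k) A m))  ∎
    where
      open ⇔-Reasoning
      Aᵏ : Fin _ → Obj
      Aᵏ i = iterT k (A i)
      mᵏ = proj₂ (hatIter k A m)

  Factors-atom : ∀ {n} (A : Fin n → Obj) {l} (B : Fin l → Obj) {R X} (r : R ⇒ prod B)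
                 (ts : (i : Fin l) → prod A ⇒ B i) (h : X ⇒ prod A) →
                 Factors h (proj₂ (atom A B r ts)) ⇔ Factors (tuple ts ∘ h) r
  Factors-atom A B r ts = Factors-pullback (Pullback.isPullback (pullback (tuple ts) r))

  theorem18 : ∀ {n} (k : ℕ) (A : Fin n → Obj) {R} (m : R ⇒ prod A) → Theorem18Concl k A m
  theorem18 k A m = SameSubobject-fromElements sameElements
    where
      open ⇔-Reasoning
      Aᵏ : Fin _ → Obj
      Aᵏ i = iterT k (A i)
      mᵏ = proj₂ (hatIter k A m)
      lhs = proj₂ (atom A A m (π A))
      rhs = proj₂ (atom A Aᵏ mᵏ (λ i → iotaIter k (A i) ∘ π A i))
      sameElements : ∀ {X} (h : X ⇒ prod A) → Factors h lhs ⇔ Factors h rhs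
      sameElements h = begin
        Factors h lhs                ≈⟨ Factors-atom A A m (π A) h ⟩
        Factors (tuple (π A) ∘ h) m  ≈⟨ Factors-cong (≈.trans (tuple-π-id A ⟩∘⟨refl) identityˡ) ⟩
        Factors h m                  ≈⟨ Factors-hatIter k A m h ⟩
        Factors (ιᵏ× k A ∘ h) mᵏ     ≈˘⟨ Factors-atom A Aᵏ mᵏ _ h ⟩
        Factors h rhs                ∎

mainTheorem18 : ∀ {o ℓ e} (M : Category o ℓ e) (HM : IsHeyting M)
    (N : Subcategory M) (HN : IsHeyting (SubCat N)) (I : IMLU M HM N HN)
    (n k : ℕ) (A : Fin n → Category.Obj M) (A-N : ∀ i → Subcategory.ObjP N (A i))
    (R : Category.Obj M) (R-N : Subcategory.ObjP N R)
    (m : Category._⇒_ M R (Notions.FinProducts.prod (IsHeyting.products HM) A))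
    (m-N : Subcategory.HomP N m) (m-mono : Notions.Mono M m) →
    Hat.Theorem18Concl I k A m
mainTheorem18 M HM N HN I n k A _ R _ m _ _ = Theorem18.theorem18 I k A m
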